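{- Let $m>5$ and let $G=\Theta(s_1,s_2,\ldots,s_m)$ be a generalized theta graph with $|s_i-s_j|\geq 2$ for all $i\neq j$. Then $\beta(G)=m-2$.
   Context: Graphs are simple, connected, finite. A set $W\subseteq V(G)$ is resolving if for any distinct $u,v$ there is $w\in W$ with $d(u,w)\ne d(v,w)$; $\beta(G)$ is the minimum size of a resolving set. For positive integers $s_1\le\cdots\le s_m$, $\Theta(s_1,\ldots,s_m)$ consists of two vertices $c_1,c_2$ (centers) joined by $m$ internally disjoint paths, the $i$-th having $s_i$ internal vertices (length $s_i+1$). -}

module Defs where

open import Data.Nat using (ℕ; zero; suc; _≤_)
open import Data.Fin using (Fin; toℕ)
open import Data.Product using (Σ; _×_; ∃; ∃-syntax)
open import Data.List using (List; length)
open import Data.List.Membership.Propositional using (_∈_)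
open import Data.List.Relation.Unary.Unique.Propositional using (Unique)
open import Relation.Binary.PropositionalEquality using (_≡_; _≢_)

data Walk {V : Set} (Adj : V → V → Set) : V → V → ℕ → Set where
  nil  : ∀ {u} → Walk Adj u u 0
  cons : ∀ {u w v n} → Adj u w → Walk Adj w v n → Walk Adj u v (suc n)

Dist : {V : Set} (Adj : V → V → Set) → V → V → ℕ → Set
Dist Adj u v d = Walk Adj u v d × (∀ n → Walk Adj u v n → d ≤ n)

Resolving : {V : Set} (Adj : V → V → Set) → List V → Set
Resolving {V} Adj W =
  ∀ (u v : V) → u ≢ v →
    ∃[ w ] (w ∈ W × ∃[ a ] ∃[ b ] (Dist Adj u w a × Dist Adj v w b × a ≢ b))

MetricDim : {V : Set} (Adj : V → V → Set) → ℕ → Set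
MetricDim {V} Adj k =
  (∃[ W ] (Unique W × Resolving Adj W × length W ≡ k)) ×
  (∀ (W : List V) → Unique W → Resolving Adj W → k ≤ length W)

data ThetaV (m : ℕ) (s : Fin m → ℕ) : Set where
  c₁ c₂ : ThetaV m s
  inner : (i : Fin m) → Fin (s i) → ThetaV m s

-- oriented edges along each path c₁ – inner i 0 – … – inner i (s i - 1) – c₂
data ThetaEdge (m : ℕ) (s : Fin m → ℕ) : ThetaV m s → ThetaV m s → Set where
  first : ∀ i (k : Fin (s i)) → toℕ k ≡ 0 → ThetaEdge m s c₁ (inner i k)
  step  : ∀ i (k k' : Fin (s i)) → suc (toℕ k) ≡ toℕ k' →
          ThetaEdge m s (inner i k) (inner i k')
  last  : ∀ i (k : Fin (s i)) → suc (toℕ k) ≡ s i → ThetaEdge m s (inner i k) c₂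

data ThetaAdj (m : ℕ) (s : Fin m → ℕ) (u v : ThetaV m s) : Set where
  fwd : ThetaEdge m s u v → ThetaAdj m s u v
  bwd : ThetaEdge m s v u → ThetaAdj m s u v

-- Path 0 is the shortest path, of length D = s₀ + 1 = d(c₁, c₂), and every other path is at
-- least two longer. The first vertices of two other paths b and c are equidistant from every
-- vertex outside b and c, since leaving c through c₂ is never shorter than going from b through
-- c₁ and round; so a resolving set meets all but one of the m − 1 long paths, and β ≥ m − 2.
-- Conversely, split a long path i as p + 1 + r with r + D ≤ p ≤ r + D + 1 and put a landmark
-- r + 1 steps before c₂. It sees every vertex u outside path i at distance r + 1 + d(u, c₂), and
-- it tells any vertex of path i from any vertex of another long path with the same distance to
-- c₁. Such landmarks on paths 1 and 2, and mirrored ones near c₁ on paths 3, …, m − 2, resolve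
-- the graph: vertices that differ in d(·, c₁) or d(·, c₂) are told apart by a landmark off
-- their paths, and distinct vertices agreeing in both lie on distinct long paths, one of which
-- carries a landmark.

module Submission where

open import Defs
open import Data.Nat
  using (ℕ; zero; suc; pred; _+_; _∸_; _≤_; _<_; _⊓_; z≤n; s≤s; ∣_-_∣; _≟_; _≤?_; _<?_)
open import Data.Nat.Properties
open import Data.Nat.Tactic.RingSolver using (solve-∀)
open import Data.Fin using (Fin; toℕ; fromℕ; fromℕ<; opposite; punchIn; inject₁; lower₁)
  renaming (zero to fzero; suc to fsuc)
import Data.Fin.Properties as Fin
open import Data.Product using (_×_; _,_; ∃-syntax; proj₁; proj₂)
open import Data.Sum using (_⊎_; inj₁; inj₂; [_,_])
open import Data.Empty using (⊥; ⊥-elim)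
open import Data.List using (List; length; lookup; tabulate)
open import Data.List.Properties using (length-tabulate)
open import Data.List.Membership.Propositional using (_∈_; lose)
open import Data.List.Membership.Propositional.Properties using (∈-tabulate⁺)
open import Data.List.Relation.Unary.Any as Any using (Any; index)
open import Data.List.Relation.Unary.Any.Properties using (lookup-index)
open import Data.List.Relation.Unary.Unique.Propositional using (Unique)
import Data.List.Relation.Unary.Unique.Propositional.Properties as Unique
open import Function using (_∘_)
open import Function.Definitions using (Injective)
open import Relation.Nullary using (¬_; yes; no; ¬?)
open import Relation.Nullary.Decidable using (decidable-stable)
open import Relation.Unary using (Decidable)
open import Relation.Binary.Definitions using (tri<; tri≈; tri>)
open import Relation.Binary.PropositionalEquality
  using (_≡_; _≢_; refl; sym; trans; cong; cong₂; subst; subst₂; module ≡-Reasoning)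

module _ {V : Set} {Adj : V → V → Set} where

  _++ʷ_ : ∀ {u v w a b} → Walk Adj u v a → Walk Adj v w b → Walk Adj u w (a + b)
  nil ++ʷ q = q
  cons e p ++ʷ q = cons e (p ++ʷ q)

  module _ {w : V} (g : V → ℕ) where

    walk-by-descent : (∀ {u} → g u ≡ 0 → u ≡ w) →
                      (∀ {u d} → g u ≡ suc d → ∃[ v ] (Adj u v × g v ≡ d)) →
                      ∀ u → Walk Adj u w (g u)
    walk-by-descent g≡0⇒w descent u = go (g u) u refl
      where
      go : ∀ d u → g u ≡ d → Walk Adj u w d
      go zero u e = subst (λ x → Walk Adj x w 0) (sym (g≡0⇒w e)) nil
      go (suc d) u e with descent e
      ... | v , u~v , e' = cons u~v (go d v e')

    lipschitz⇒walk-length≥ : (∀ {u v} → Adj u v → g u ≤ suc (g v)) → g w ≡ 0 →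
                              ∀ {u n} → Walk Adj u w n → g u ≤ n
    lipschitz⇒walk-length≥ lip g-w nil = ≤-reflexive g-w
    lipschitz⇒walk-length≥ lip g-w (cons u~v p) =
      ≤-trans (lip u~v) (s≤s (lipschitz⇒walk-length≥ lip g-w p))

    Dist-by-potential : (∀ {u v} → Adj u v → g u ≤ suc (g v)) → g w ≡ 0 →
                        (∀ {u} → g u ≡ 0 → u ≡ w) →
                        (∀ {u d} → g u ≡ suc d → ∃[ v ] (Adj u v × g v ≡ d)) →
                        ∀ u → Dist Adj u w (g u)
    Dist-by-potential lip g-w g≡0⇒w descent u =
      walk-by-descent g≡0⇒w descent u , λ n → lipschitz⇒walk-length≥ lip g-w

module _ {A : Set} where

  injection-into-list⇒length≥ : ∀ {k l} (P : Fin k → A → Set) →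
    (∀ {i j a} → P i a → P j a → i ≡ j) → (xs : List A) (f : Fin l → Fin k) →
    Injective _≡_ _≡_ f → (∀ t → Any (P (f t)) xs) → l ≤ length xs
  injection-into-list⇒length≥ P disjoint xs f f-inj meets = ≮⇒≥ λ lt →
    let (t , t' , t<t' , same) = Fin.pigeonhole lt (λ t → index (meets t))
    in Fin.<⇒≢ t<t' (f-inj (disjoint (lookup-index (meets t))
         (subst (P (f t')) (cong (lookup xs) (sym same)) (lookup-index (meets t')))))

  meets-all-but-one⇒length≥ : ∀ {k} (P : Fin k → A → Set) → (∀ i → Decidable (P i)) →
    (∀ {i j a} → P i a → P j a → i ≡ j) → (xs : List A) →
    (∀ i j → i ≢ j → Any (P i) xs ⊎ Any (P j) xs) → pred k ≤ length xs
  meets-all-but-one⇒length≥ {zero} P P? disjoint xs meets = z≤n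
  meets-all-but-one⇒length≥ {suc k} P P? disjoint xs meets
    with Fin.any? (λ c → ¬? (Any.any? (P? c) xs))
  ... | yes (c , c-missed) =
    injection-into-list⇒length≥ P disjoint xs (punchIn c) (Fin.punchIn-injective c _ _) met
    where
    met : ∀ t → Any (P (punchIn c t)) xs
    met t with meets (punchIn c t) c (Fin.punchInᵢ≢i c t)
    ... | inj₁ hit = hit
    ... | inj₂ hit = ⊥-elim (c-missed hit)
  ... | no none-missed =
    ≤-trans (n≤1+n k) (injection-into-list⇒length≥ P disjoint xs (λ t → t) (λ e → e)
      λ c → decidable-stable (Any.any? (P? c) xs) (λ missed → none-missed (c , missed)))

∣m-n∣≡1+∣1+m-n∣ : ∀ {m n} → m < n → ∣ m - n ∣ ≡ suc ∣ suc m - n ∣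
∣m-n∣≡1+∣1+m-n∣ {zero} {suc n} _ = refl
∣m-n∣≡1+∣1+m-n∣ {suc m} {suc n} (s≤s m<n) = ∣m-n∣≡1+∣1+m-n∣ m<n

∣1+m-n∣≡1+∣m-n∣ : ∀ {m n} → n ≤ m → ∣ suc m - n ∣ ≡ suc ∣ m - n ∣
∣1+m-n∣≡1+∣m-n∣ {m} {n} n≤m = begin
  ∣ suc m - n ∣  ≡⟨ ∣-∣-comm (suc m) n ⟩
  ∣ n - suc m ∣  ≡⟨ ∣m-n∣≡1+∣1+m-n∣ (s≤s n≤m) ⟩
  suc ∣ suc n - suc m ∣  ≡⟨ cong suc (∣-∣-comm n m) ⟩
  suc ∣ m - n ∣  ∎
  where open ≡-Reasoning

infix 4 _≈₁_
_≈₁_ : ℕ → ℕ → Set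
a ≈₁ b = a ≤ suc b × b ≤ suc a

+-≈₁ : ∀ c {a b} → a ≈₁ b → c + a ≈₁ c + b
+-≈₁ c {a} {b} (a≤1+b , b≤1+a) =
  ≤-trans (+-monoʳ-≤ c a≤1+b) (≤-reflexive (+-suc c b)) ,
  ≤-trans (+-monoʳ-≤ c b≤1+a) (≤-reflexive (+-suc c a))

∣m-n∣≈₁∣1+m-n∣ : ∀ m n → ∣ m - n ∣ ≈₁ ∣ suc m - n ∣
∣m-n∣≈₁∣1+m-n∣ zero zero = z≤n , ≤-refl
∣m-n∣≈₁∣1+m-n∣ zero (suc n) = ≤-refl , m≤n⇒m≤1+n (n≤1+n n)
∣m-n∣≈₁∣1+m-n∣ (suc m) zero = m≤n⇒m≤1+n (n≤1+n (suc m)) , ≤-refl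
∣m-n∣≈₁∣1+m-n∣ (suc m) (suc n) = ∣m-n∣≈₁∣1+m-n∣ m n

<⇒≡suc : ∀ {m n} → m < n → ∃[ n' ] (n ≡ suc n' × m ≤ n')
<⇒≡suc (s≤s m≤n') = _ , refl , m≤n'

balanced-split : ∀ d {s} → d < s → ∃[ r ] ∃[ p ] (p + suc r ≡ s × r + d ≤ p × p ≤ suc (r + d))
balanced-split d {suc s} (s≤s d≤s) with m≤n⇒m<n∨m≡n d≤s
... | inj₂ refl = 0 , d , +-comm d 1 , ≤-refl , n≤1+n d
... | inj₁ d<s with balanced-split d d<s
...   | r , p , p+1+r≡s , r+d≤p , p≤1+r+d with p ≤? r + d
...     | yes p≤r+d = r , suc p , cong suc p+1+r≡s , m≤n⇒m≤1+n r+d≤p , s≤s p≤r+d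
...     | no p≰r+d = suc r , p , trans (+-suc p (suc r)) (cong suc p+1+r≡s) , ≰⇒> p≰r+d ,
                     m≤n⇒m≤1+n p≤1+r+d

module Theta {m : ℕ} (s : Fin m → ℕ) where

  V : Set
  V = ThetaV m s

  Adj : V → V → Set
  Adj = ThetaAdj m s

  Edge : V → V → Set
  Edge = ThetaEdge m s

  after : ∀ j → Fin (s j) → ℕ
  after j k = s j ∸ suc (toℕ k)

  toℕ+after : ∀ j (k : Fin (s j)) → toℕ k + suc (after j k) ≡ s j
  toℕ+after j k = trans (+-suc (toℕ k) (after j k)) (m+[n∸m]≡n (Fin.toℕ<n k))

  after-step : ∀ j {k k' : Fin (s j)} → suc (toℕ k) ≡ toℕ k' → after j k ≡ suc (after j k')
  after-step j {k' = k'} e = trans (cong (s j ∸_) e) (+-∸-assoc 1 (Fin.toℕ<n k'))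

  after-last : ∀ j {k : Fin (s j)} → suc (toℕ k) ≡ s j → after j k ≡ 0
  after-last j e = trans (cong (s j ∸_) e) (n∸n≡0 (s j))

  after-opposite : ∀ j (k : Fin (s j)) → after j (opposite k) ≡ toℕ k
  after-opposite j k = begin
    s j ∸ suc (toℕ (opposite k))  ≡⟨ cong (λ t → s j ∸ suc t) (Fin.opposite-prop k) ⟩
    s j ∸ suc (after j k)         ≡⟨ cong (s j ∸_) (+-∸-assoc 1 (Fin.toℕ<n k)) ⟨
    s j ∸ (s j ∸ toℕ k)           ≡⟨ m∸[m∸n]≡n (<⇒≤ (Fin.toℕ<n k)) ⟩
    toℕ k                         ∎
    where open ≡-Reasoning

  next : ∀ {j} (k : Fin (s j)) → suc (toℕ k) < s j → ∃[ k' ] suc (toℕ k) ≡ toℕ k'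
  next k lt = fromℕ< lt , sym (Fin.toℕ-fromℕ< lt)

  prev : ∀ {j} (k : Fin (s j)) {a} → toℕ k ≡ suc a → ∃[ k' ] (suc (toℕ k') ≡ toℕ k × toℕ k' ≡ a)
  prev {j} k {a} e = fromℕ< a<s , trans (cong suc (Fin.toℕ-fromℕ< a<s)) (sym e) , Fin.toℕ-fromℕ< a<s
    where
    a<s : a < s j
    a<s = <-trans (n<1+n a) (subst (_< s j) e (Fin.toℕ<n k))

  OnPath : Fin m → V → Set
  OnPath i u = ∃[ k ] u ≡ inner i k

  onPath? : ∀ i → Decidable (OnPath i)
  onPath? i c₁ = no λ ()
  onPath? i c₂ = no λ ()
  onPath? i (inner j k) with j Fin.≟ i
  ... | yes refl = yes (k , refl)
  ... | no j≢i = no λ { (_ , refl) → j≢i refl }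

  onPath-unique : ∀ {i j u} → OnPath i u → OnPath j u → i ≡ j
  onPath-unique (_ , refl) (_ , refl) = refl

  offPath-other : ∀ {i j u} → i ≢ j → OnPath i u → ¬ OnPath j u
  offPath-other i≢j on-i on-j = i≢j (onPath-unique on-i on-j)

  stays-off-path : ∀ {i j k v} → OnPath j v → ¬ OnPath i (inner j k) → ¬ OnPath i v
  stays-off-path (_ , refl) off (_ , refl) = off (_ , refl)

  two-paths : ∀ {a b} → a ≢ b → ∀ u v →
    (¬ OnPath a u × ¬ OnPath a v) ⊎ (¬ OnPath b u × ¬ OnPath b v) ⊎
    (OnPath a u × OnPath b v) ⊎ (OnPath b u × OnPath a v)
  two-paths {a} {b} a≢b u v with onPath? a u | onPath? a v
  ... | no u∉a | no v∉a = inj₁ (u∉a , v∉a)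
  ... | yes u∈a | _ with onPath? b v
  ...   | yes v∈b = inj₂ (inj₂ (inj₁ (u∈a , v∈b)))
  ...   | no v∉b = inj₂ (inj₁ (offPath-other a≢b u∈a , v∉b))
  two-paths {a} {b} a≢b u v | no _ | yes v∈a with onPath? b u
  ...   | yes u∈b = inj₂ (inj₂ (inj₂ (u∈b , v∈a)))
  ...   | no u∉b = inj₂ (inj₁ (u∉b , offPath-other a≢b v∈a))

  exit : ∀ {b w N} (k : Fin (s b)) → ¬ OnPath b w → Walk Adj (inner b k) w N →
    (∃[ N₁ ] (Walk Adj c₁ w N₁ × suc (toℕ k) + N₁ ≤ N)) ⊎
    (∃[ N₂ ] (Walk Adj c₂ w N₂ × suc (after b k) + N₂ ≤ N))
  exit k w∉b nil = ⊥-elim (w∉b (k , refl))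
  exit k w∉b (cons (fwd (step _ _ k' e)) p) with exit k' w∉b p
  ... | inj₁ (N₁ , q , le) =
    inj₁ (N₁ , q , m≤n⇒m≤1+n (≤-trans (≤-trans (≤-reflexive (cong (_+ N₁) e)) (n≤1+n _)) le))
  ... | inj₂ (N₂ , q , le) =
    inj₂ (N₂ , q , ≤-trans (≤-reflexive (cong (λ t → suc t + N₂) (after-step _ e))) (s≤s le))
  exit {N = suc N} k w∉b (cons (fwd (last _ _ e)) p) =
    inj₂ (N , p , ≤-reflexive (cong (λ t → suc t + N) (after-last _ e)))
  exit {N = suc N} k w∉b (cons (bwd (first _ _ e)) p) =
    inj₁ (N , p , ≤-reflexive (cong (λ t → suc t + N) e))
  exit k w∉b (cons (bwd (step _ k₀ _ e)) p) with exit k₀ w∉b p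
  ... | inj₁ (N₁ , q , le) =
    inj₁ (N₁ , q , ≤-trans (≤-reflexive (cong (λ t → suc t + N₁) (sym e))) (s≤s le))
  ... | inj₂ (N₂ , q , le) =
    inj₂ (N₂ , q , m≤n⇒m≤1+n (≤-trans (≤-trans (≤-reflexive (cong (_+ N₂) (sym (after-step _ e))))
      (n≤1+n _)) le))

  reflect : V → V
  reflect c₁ = c₂
  reflect c₂ = c₁
  reflect (inner j k) = inner j (opposite k)

  reflect-involutive : ∀ u → reflect (reflect u) ≡ u
  reflect-involutive c₁ = refl
  reflect-involutive c₂ = refl
  reflect-involutive (inner j k) = cong (inner j) (Fin.opposite-involutive k)

  reflect-offPath : ∀ {i u} → ¬ OnPath i u → ¬ OnPath i (reflect u)
  reflect-offPath {u = u} u∉i (k , e) =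
    u∉i (opposite k , trans (sym (reflect-involutive u)) (cong reflect e))

  reflect-edge : ∀ {u v} → Edge u v → Edge (reflect v) (reflect u)
  reflect-edge (first j k e) = last j (opposite k)
    (trans (cong suc (Fin.opposite-prop k))
           (trans (cong (λ t → t + suc (after j k)) (sym e)) (toℕ+after j k)))
  reflect-edge (step j k k' e) = step j (opposite k') (opposite k)
    (trans (cong suc (Fin.opposite-prop k')) (trans (sym (after-step j e)) (sym (Fin.opposite-prop k))))
  reflect-edge (last j k e) = first j (opposite k) (trans (Fin.opposite-prop k) (after-last j e))

  reflect-adj : ∀ {u v} → Adj u v → Adj (reflect u) (reflect v)
  reflect-adj (fwd e) = bwd (reflect-edge e)
  reflect-adj (bwd e) = fwd (reflect-edge e)

  reflect-walk : ∀ {u v n} → Walk Adj u v n → Walk Adj (reflect u) (reflect v) n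
  reflect-walk nil = nil
  reflect-walk (cons u~v p) = cons (reflect-adj u~v) (reflect-walk p)

  Dist-reflect : ∀ {u w d} → Dist Adj (reflect u) w d → Dist Adj u (reflect w) d
  Dist-reflect {u} {w} {d} (p , shortest) =
    subst (λ x → Walk Adj x (reflect w) d) (reflect-involutive u) (reflect-walk p) ,
    λ n q → shortest n (subst (λ x → Walk Adj (reflect u) x n) (reflect-involutive w) (reflect-walk q))

module ShortestPathGap {k : ℕ} (s : Fin (suc k) → ℕ) (s₀-pos : 1 ≤ s fzero)
  (gap : ∀ j → j ≢ fzero → 2 + s fzero ≤ s j) where

  open Theta s

  D : ℕ
  D = suc (s fzero)

  s₀≤ : ∀ j → s fzero ≤ s j
  s₀≤ j with j Fin.≟ fzero
  ... | yes refl = ≤-refl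
  ... | no j≢0 = ≤-trans (m≤n+m (s fzero) 2) (gap j j≢0)

  start : ∀ j → Fin (s j)
  start j = fromℕ< (≤-trans s₀-pos (s₀≤ j))

  toℕ-start : ∀ j → toℕ (start j) ≡ 0
  toℕ-start j = Fin.toℕ-fromℕ< _

  1+after-start : ∀ j → suc (after j (start j)) ≡ s j
  1+after-start j =
    trans (cong (λ t → t + suc (after j (start j))) (sym (toℕ-start j))) (toℕ+after j (start j))

  -- The shorter of the two ways from an internal vertex to a center: a + 1 steps along its path,
  -- or b + 1 steps to the other center and D more on path 0.
  around : ℕ → ℕ → ℕ
  around a b = suc a ⊓ (suc b + D)

  -- X and Y are the distances to c₁ and c₂, but only their closed forms are ever used.
  X Y : V → ℕ
  X c₁ = 0
  X c₂ = D
  X (inner j k) = around (toℕ k) (after j k)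
  Y c₁ = D
  Y c₂ = 0
  Y (inner j k) = around (after j k) (toℕ k)

  around-near : ∀ {a b} → suc a ≤ suc b + D → around a b ≡ suc a
  around-near = m≤n⇒m⊓n≡m

  around-far : ∀ {a b} → suc b + D ≤ suc a → around a b ≡ suc b + D
  around-far = m≥n⇒m⊓n≡n

  around-step : ∀ a b → around (suc a) b ≈₁ around a (suc b)
  around-step a b = ⊓-mono-≤ (≤-refl {suc (suc a)}) (m≤n⇒m≤1+n (n≤1+n _)) ,
                    ⊓-mono-≤ (m≤n⇒m≤1+n (n≤1+n _)) (≤-refl {suc (suc b) + D})

  around-cases : ∀ a b → around a b ≡ suc a ⊎ (around b a ≡ suc b × around a b ≡ around b a + D)
  around-cases a b with suc a ≤? suc b + D
  ... | yes near = inj₁ (around-near near)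
  ... | no far =
    inj₂ (around-near b-near , trans (around-far far') (cong (_+ D) (sym (around-near b-near))))
    where
    far' : suc b + D ≤ suc a
    far' = <⇒≤ (≰⇒> far)
    b-near : suc b ≤ suc a + D
    b-near = ≤-trans (m≤m+n (suc b) D) (≤-trans far' (m≤m+n (suc a) D))

  around-below-far : ∀ {a b} → around a b < suc b + D → around a b ≡ suc a
  around-below-far {a} {b} lt with suc a ≤? suc b + D
  ... | yes near = around-near near
  ... | no far = ⊥-elim (<-irrefl (around-far (<⇒≤ (≰⇒> far))) lt)

  around-injective-mixed : ∀ {a b a' b'} → a + suc b ≡ a' + suc b' →
    around a b ≡ suc a → around b' a' ≡ suc b' → around a' b' ≡ around b' a' + D →
    around a b ≡ around a' b' → around b a ≡ around b' a' → a ≡ a'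
  around-injective-mixed {a} {b} {a'} {b'} sum x y' xy' eX eY =
    +-cancelʳ-≡ (suc b) a a' (trans sum (cong (a' +_) (sym b≡b')))
    where
    1+a≡1+b'+D : suc a ≡ suc b' + D
    1+a≡1+b'+D = trans (sym x) (trans eX (trans xy' (cong (_+ D) y')))
    around-b-a≡1+b' : around b a ≡ suc b'
    around-b-a≡1+b' = trans eY y'
    1+b'<1+a+D : suc b' < suc a + D
    1+b'<1+a+D =
      ≤-trans (m<m+n (suc b') (s≤s z≤n)) (≤-trans (≤-reflexive (sym 1+a≡1+b'+D)) (m≤m+n (suc a) D))
    b≡b' : suc b ≡ suc b'
    b≡b' = trans (sym (around-below-far (subst (_< suc a + D) (sym around-b-a≡1+b') 1+b'<1+a+D)))
                 around-b-a≡1+b'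

  around-injective : ∀ {a b a' b'} → a + suc b ≡ a' + suc b' →
    around a b ≡ around a' b' → around b a ≡ around b' a' → a ≡ a'
  around-injective {a} {b} {a'} {b'} sum eX eY with around-cases a b | around-cases a' b'
  ... | inj₁ x | inj₁ x' = suc-injective (trans (sym x) (trans eX x'))
  ... | inj₂ (y , _) | inj₂ (y' , _) =
    +-cancelʳ-≡ (suc b) a a' (trans sum (cong (a' +_) (sym (trans (sym y) (trans eY y')))))
  ... | inj₁ x | inj₂ (y' , xy') = around-injective-mixed sum x y' xy' eX eY
  ... | inj₂ (y , xy) | inj₁ x' = sym (around-injective-mixed (sym sum) x' y xy (sym eX) (sym eY))

  around-sum-near : ∀ {a b} → a ≤ b + D → b ≤ a + D → around a b + around b a ≡ suc a + suc b
  around-sum-near a≤ b≤ = cong₂ _+_ (around-near (s≤s a≤)) (around-near (s≤s b≤))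

  around-sum-far : ∀ {a b} → around a b ≡ suc b + D → 2 + D ≤ around a b + around b a
  around-sum-far {a} {b} far = begin
    2 + D                        ≤⟨ s≤s (s≤s (≤-trans (m≤n+m D b) (m≤m+n (b + D) (b ⊓ (a + D))))) ⟩
    suc (suc (b + D + b ⊓ (a + D))) ≡⟨ cong suc (+-suc (b + D) _) ⟨
    suc b + D + around b a       ≡⟨ cong (_+ around b a) far ⟨
    around a b + around b a      ∎
    where open ≤-Reasoning

  around-sum-long : ∀ a b → suc D ≤ a + suc b → 2 + D ≤ around a b + around b a
  around-sum-long a b long with suc a ≤? suc b + D | suc b ≤? suc a + D
  ... | yes a-near | yes b-near =
    subst (2 + D ≤_) (sym (cong₂ _+_ (around-near a-near) (around-near b-near))) (s≤s long)
  ... | no a-far | _ = around-sum-far (around-far (<⇒≤ (≰⇒> a-far)))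
  ... | yes _ | no b-far =
    subst (2 + D ≤_) (+-comm (around b a) (around a b)) (around-sum-far (around-far (<⇒≤ (≰⇒> b-far))))

  X-reflect : ∀ u → X (reflect u) ≡ Y u
  X-reflect c₁ = refl
  X-reflect c₂ = refl
  X-reflect (inner j k) = cong₂ around (Fin.opposite-prop k) (after-opposite j k)

  Y-reflect : ∀ u → Y (reflect u) ≡ X u
  Y-reflect c₁ = refl
  Y-reflect c₂ = refl
  Y-reflect (inner j k) = cong₂ around (after-opposite j k) (Fin.opposite-prop k)

  X≡0⇒c₁ : ∀ {u} → X u ≡ 0 → u ≡ c₁
  X≡0⇒c₁ {c₁} _ = refl

  Y≡0⇒c₂ : ∀ {u} → Y u ≡ 0 → u ≡ c₂
  Y≡0⇒c₂ {c₂} _ = refl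

  position-unique : ∀ {j} (k k' : Fin (s j)) →
    X (inner j k) ≡ X (inner j k') → Y (inner j k) ≡ Y (inner j k') → k ≡ k'
  position-unique {j} k k' eX eY =
    Fin.toℕ-injective (around-injective (trans (toℕ+after j k) (sym (toℕ+after j k'))) eX eY)

  on-path₀-sum : ∀ (k : Fin (s fzero)) → X (inner fzero k) + Y (inner fzero k) ≡ D
  on-path₀-sum k = trans (around-sum-near (≤-trans a≤s₀ s₀≤b+D) (≤-trans b≤s₀ s₀≤a+D))
                         (cong suc (toℕ+after fzero k))
    where
    a≤s₀ : toℕ k ≤ s fzero
    a≤s₀ = ≤-trans (m≤m+n (toℕ k) _) (≤-reflexive (toℕ+after fzero k))
    b≤s₀ : after fzero k ≤ s fzero
    b≤s₀ = ≤-trans (≤-trans (n≤1+n _) (m≤n+m _ (toℕ k))) (≤-reflexive (toℕ+after fzero k))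
    s₀≤b+D : s fzero ≤ after fzero k + D
    s₀≤b+D = ≤-trans (n≤1+n _) (m≤n+m D _)
    s₀≤a+D : s fzero ≤ toℕ k + D
    s₀≤a+D = ≤-trans (n≤1+n _) (m≤n+m D _)

  on-long-path-sum : ∀ {j} → j ≢ fzero → (k : Fin (s j)) → 2 + D ≤ X (inner j k) + Y (inner j k)
  on-long-path-sum {j} j≢0 k =
    around-sum-long (toℕ k) (after j k) (subst (suc D ≤_) (sym (toℕ+after j k)) (gap j j≢0))

  Y-edge : ∀ {u v} → Edge u v → Y u ≈₁ Y v
  Y-edge (first j k e) =
    s≤s (⊓-glb (≤-trans (s₀≤ j) (≤-reflexive s≡1+after)) (≤-trans (n≤1+n _) (m≤n+m D (suc (toℕ k))))) ,
    ≤-trans (m⊓n≤n _ _) (≤-reflexive (cong (λ t → suc t + D) e))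
    where
    s≡1+after : s j ≡ suc (after j k)
    s≡1+after = trans (sym (toℕ+after j k)) (cong (_+ suc (after j k)) e)
  Y-edge (step j k k' e) =
    subst₂ _≈₁_
      (cong (λ t → around t (toℕ k)) (sym (after-step j e))) (cong (around (after j k')) e)
      (around-step (after j k') (toℕ k))
  Y-edge (last j k e) = ≤-reflexive (cong (λ t → around t (toℕ k)) (after-last j e)) , z≤n

  -- Only the step from c₁ enters a path that u is not on, namely path 0.
  StepToC₂ : V → ℕ → Set
  StepToC₂ u y = ∃[ v ] (Adj u v × Y v ≡ y × (OnPath fzero v ⊎ (∀ {i} → ¬ OnPath i u → ¬ OnPath i v)))

  step-along-to-c₂ : ∀ {j} (k : Fin (s j)) {y} → after j k ≡ y → suc (after j k) ≤ suc (toℕ k) + D →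
    StepToC₂ (inner j k) y
  step-along-to-c₂ {j} k {zero} e _ = c₂ , fwd (last j k 1+k≡s) , refl , inj₂ (λ _ ())
    where
    1+k≡s : suc (toℕ k) ≡ s j
    1+k≡s = trans (+-comm 1 (toℕ k)) (trans (cong (λ t → toℕ k + suc t) (sym e)) (toℕ+after j k))
  step-along-to-c₂ {j} k {suc y} e near with next k (m∸n≢0⇒n<m (λ e₀ → 0≢1+n (trans (sym e₀) e)))
  ... | k' , 1+k≡k' = inner j k' , fwd (step j k k' 1+k≡k') , Y≡ , inj₂ (stays-off-path (k' , refl))
    where
    Y≡ : around (after j k') (toℕ k') ≡ suc y
    Y≡ = trans (cong₂ around (suc-injective (trans (sym (after-step j 1+k≡k')) e)) (sym 1+k≡k'))
               (around-near {b = suc (toℕ k)} (≤-trans (≤-trans (n≤1+n (suc y)) (≤-reflexive (cong suc (sym e))))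
                                                      (≤-trans near (n≤1+n _))))

  step-back-to-c₂ : ∀ {j} (k : Fin (s j)) {a} → toℕ k ≡ a → suc a + D ≤ suc (after j k) →
    StepToC₂ (inner j k) (a + D)
  step-back-to-c₂ {j} k {zero} e _ = c₁ , bwd (first j k e) , refl , inj₂ (λ _ ())
  step-back-to-c₂ {j} k {suc a} e far with prev k e
  ... | k₀ , 1+k₀≡k , k₀≡a =
    inner j k₀ , bwd (step j k₀ k 1+k₀≡k) , Y≡ , inj₂ (stays-off-path (k₀ , refl))
    where
    Y≡ : around (after j k₀) (toℕ k₀) ≡ suc a + D
    Y≡ = trans (cong₂ around (after-step j 1+k₀≡k) k₀≡a)
               (around-far (≤-trans (n≤1+n _) (≤-trans far (n≤1+n _))))

  Y-descent : ∀ {y} u → Y u ≡ suc y → StepToC₂ u y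
  Y-descent c₁ e = inner fzero (start fzero) , fwd (first fzero (start fzero) (toℕ-start fzero)) ,
    trans (around-near {b = b} (≤-trans (≤-reflexive (1+after-start fzero))
                                        (≤-trans (n≤1+n _) (m≤n+m D (suc b)))))
          (trans (1+after-start fzero) (suc-injective e)) ,
    inj₁ (_ , refl)
    where
    b : ℕ
    b = toℕ (start fzero)
  Y-descent (inner j k) e with suc (after j k) ≤? suc (toℕ k) + D
  ... | yes near = step-along-to-c₂ k (suc-injective (trans (sym (around-near near)) e)) near
  ... | no far = subst (StepToC₂ (inner j k)) (suc-injective (trans (sym (around-far far')) e))
                       (step-back-to-c₂ k refl far')
    where
    far' : suc (toℕ k) + D ≤ suc (after j k)
    far' = <⇒≤ (≰⇒> far)

  walk-to-c₂ : ∀ u → Walk Adj u c₂ (Y u)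
  walk-to-c₂ = walk-by-descent Y Y≡0⇒c₂ λ {u} e → let (v , u~v , e' , _) = Y-descent u e in v , u~v , e'

  path₀-coordinates-not-shared : ∀ (k : Fin (s fzero)) {j} (k' : Fin (s j)) → j ≢ fzero →
    X (inner fzero k) ≡ X (inner j k') → Y (inner fzero k) ≡ Y (inner j k') → ⊥
  path₀-coordinates-not-shared k k' j≢0 eX eY = 1+n≰n (begin
    suc D                                   ≤⟨ n≤1+n _ ⟩
    2 + D                                   ≤⟨ on-long-path-sum j≢0 k' ⟩
    X (inner _ k') + Y (inner _ k')         ≡⟨ cong₂ _+_ eX eY ⟨
    X (inner fzero k) + Y (inner fzero k)   ≡⟨ on-path₀-sum k ⟩
    D                                       ∎)
    where open ≤-Reasoning

  start-to-c₁ : ∀ j → Adj (inner j (start j)) c₁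
  start-to-c₁ j = bwd (first j (start j) (toℕ-start j))

  -- Leaving path c through c₂ costs s c ≥ D + 1, no less than going from the start of b to c₁
  -- and round to c₂.
  start-dist-≤ : ∀ {b c w d₁ d₂} → c ≢ fzero → ¬ OnPath c w →
    Dist Adj (inner b (start b)) w d₁ → Dist Adj (inner c (start c)) w d₂ → d₁ ≤ d₂
  start-dist-≤ {b} {c} c≢0 w∉c (_ , shortest) (p , _) with exit (start c) w∉c p
  ... | inj₁ (N₁ , q , le) =
    ≤-trans (shortest _ (cons (start-to-c₁ b) q))
            (≤-trans (≤-reflexive (cong (λ t → suc t + N₁) (sym (toℕ-start c)))) le)
  ... | inj₂ (N₂ , q , le) =
    ≤-trans (shortest _ (cons (start-to-c₁ b) (walk-to-c₂ c₁ ++ʷ q)))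
            (≤-trans (+-monoˡ-≤ N₂ (≤-trans (gap c c≢0) (≤-reflexive (sym (1+after-start c))))) le)

  starts-equidistant : ∀ {b c w d₁ d₂} → b ≢ fzero → c ≢ fzero → ¬ OnPath b w → ¬ OnPath c w →
    Dist Adj (inner b (start b)) w d₁ → Dist Adj (inner c (start c)) w d₂ → d₁ ≡ d₂
  starts-equidistant b≢0 c≢0 w∉b w∉c dist₁ dist₂ =
    ≤-antisym (start-dist-≤ c≢0 w∉c dist₁ dist₂) (start-dist-≤ b≢0 w∉b dist₂ dist₁)

  resolving-meets-all-but-one-path : ∀ W → Resolving Adj W → ∀ i j → i ≢ j →
    Any (OnPath (fsuc i)) W ⊎ Any (OnPath (fsuc j)) W
  resolving-meets-all-but-one-path W resolves i j i≢j
    with Any.any? (onPath? (fsuc i)) W | Any.any? (onPath? (fsuc j)) W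
  ... | yes meets-i | _ = inj₁ meets-i
  ... | no _ | yes meets-j = inj₂ meets-j
  ... | no misses-i | no misses-j
    with resolves (inner (fsuc i) (start _)) (inner (fsuc j) (start _)) (λ { refl → i≢j refl })
  ...   | w , w∈W , _ , _ , dist₁ , dist₂ , d₁≢d₂ =
    ⊥-elim (d₁≢d₂ (starts-equidistant (λ ()) (λ ()) (misses-i ∘ lose w∈W) (misses-j ∘ lose w∈W)
                                      dist₁ dist₂))

  lower-bound : ∀ W → Resolving Adj W → pred k ≤ length W
  lower-bound W resolves =
    meets-all-but-one⇒length≥ (OnPath ∘ fsuc) (onPath? ∘ fsuc)
      (λ on-i on-j → Fin.suc-injective (onPath-unique on-i on-j)) W
      (resolving-meets-all-but-one-path W resolves)

  module Landmark (i : Fin (suc k)) (i≢0 : i ≢ fzero) where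

    private
      split : ∃[ r ] ∃[ p ] (p + suc r ≡ s i × r + D ≤ p × p ≤ suc (r + D))
      split = balanced-split D (gap i i≢0)

    r p : ℕ
    r = proj₁ split
    p = proj₁ (proj₂ split)

    p+1+r≡s : p + suc r ≡ s i
    p+1+r≡s = proj₁ (proj₂ (proj₂ split))

    r+D≤p : r + D ≤ p
    r+D≤p = proj₁ (proj₂ (proj₂ (proj₂ split)))

    p≤1+r+D : p ≤ suc (r + D)
    p≤1+r+D = proj₂ (proj₂ (proj₂ (proj₂ split)))

    p<s : p < s i
    p<s = subst (p <_) p+1+r≡s (m<m+n p (s≤s z≤n))

    landmark : V
    landmark = inner i (fromℕ< p<s)

    -- The distance to the landmark: along path i from inside it, and through c₂ from anywhere
    -- else, as r + D ≤ p makes the way round through c₁ no shorter.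
    δ : V → ℕ
    δ c₁ = suc r + D
    δ c₂ = suc r + 0
    δ (inner j k) with j Fin.≟ i
    ... | yes _ = ∣ toℕ k - p ∣
    ... | no _ = suc r + Y (inner j k)

    δ-on : ∀ k → δ (inner i k) ≡ ∣ toℕ k - p ∣
    δ-on k with i Fin.≟ i
    ... | yes _ = refl
    ... | no i≢i = ⊥-elim (i≢i refl)

    δ-off : ∀ {u} → ¬ OnPath i u → δ u ≡ suc r + Y u
    δ-off {c₁} _ = refl
    δ-off {c₂} _ = refl
    δ-off {inner j k} u∉i with j Fin.≟ i
    ... | yes refl = ⊥-elim (u∉i (k , refl))
    ... | no _ = refl

    δ-last : ∀ {k : Fin (s i)} → suc (toℕ k) ≡ s i → ∣ toℕ k - p ∣ ≡ r
    δ-last {k} e = begin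
      ∣ toℕ k - p ∣  ≡⟨ cong ∣_- p ∣ (suc-injective (trans e (trans (sym p+1+r≡s) (+-suc p r)))) ⟩
      ∣ p + r - p ∣  ≡⟨ ∣-∣-comm (p + r) p ⟩
      ∣ p - p + r ∣  ≡⟨ ∣m-m+n∣≡n p r ⟩
      r              ∎
      where open ≡-Reasoning

    δ-edge : ∀ {u v} → Edge u v → δ u ≈₁ δ v
    δ-edge (first j k e) with j Fin.≟ i
    ... | no _ = +-≈₁ (suc r) (Y-edge (first j k e))
    ... | yes refl rewrite e = s≤s r+D≤p , m≤n⇒m≤1+n p≤1+r+D
    δ-edge (step j k k' e) with j Fin.≟ i
    ... | no _ = +-≈₁ (suc r) (Y-edge (step j k k' e))
    ... | yes refl rewrite sym e = ∣m-n∣≈₁∣1+m-n∣ (toℕ k) p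
    δ-edge (last j k e) with j Fin.≟ i
    ... | no _ = +-≈₁ (suc r) (Y-edge (last j k e))
    ... | yes refl rewrite δ-last e | +-identityʳ r = m≤n⇒m≤1+n (n≤1+n r) , ≤-refl

    δ-lipschitz : ∀ {u v} → Adj u v → δ u ≤ suc (δ v)
    δ-lipschitz (fwd e) = proj₁ (δ-edge e)
    δ-lipschitz (bwd e) = proj₂ (δ-edge e)

    δ-landmark : δ landmark ≡ 0
    δ-landmark = trans (δ-on _) (trans (cong ∣_- p ∣ (Fin.toℕ-fromℕ< p<s)) (∣n-n∣≡0 p))

    δ≡0⇒landmark : ∀ {u} → δ u ≡ 0 → u ≡ landmark
    δ≡0⇒landmark {inner j k} e with j Fin.≟ i
    ... | yes refl =
      cong (inner i) (Fin.toℕ-injective (trans (∣m-n∣≡0⇒m≡n e) (sym (Fin.toℕ-fromℕ< p<s))))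

    descent-on : ∀ (k : Fin (s i)) {d} → ∣ toℕ k - p ∣ ≡ suc d → ∃[ v ] (Adj (inner i k) v × δ v ≡ d)
    descent-on k e with <-cmp (toℕ k) p
    ... | tri< k<p _ _ with next k (≤-<-trans k<p p<s)
    ...   | k' , 1+k≡k' = inner i k' , fwd (step i k k' 1+k≡k') ,
      trans (δ-on k') (trans (cong ∣_- p ∣ (sym 1+k≡k'))
        (suc-injective (trans (sym (∣m-n∣≡1+∣1+m-n∣ k<p)) e)))
    descent-on k e | tri≈ _ k≡p _ = ⊥-elim (0≢1+n (trans (sym (m≡n⇒∣m-n∣≡0 k≡p)) e))
    descent-on k e | tri> _ _ p<k with <⇒≡suc p<k
    ...   | a , k≡1+a , p≤a with prev k k≡1+a
    ...     | k₀ , 1+k₀≡k , k₀≡a = inner i k₀ , bwd (step i k₀ k 1+k₀≡k) ,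
      trans (δ-on k₀) (trans (cong ∣_- p ∣ k₀≡a)
        (suc-injective (trans (sym (∣1+m-n∣≡1+∣m-n∣ p≤a)) (trans (cong ∣_- p ∣ (sym k≡1+a)) e))))

    descent-off : ∀ u → ¬ OnPath i u → ∀ {d} → suc r + Y u ≡ suc d → ∃[ v ] (Adj u v × δ v ≡ d)
    descent-off u u∉i e with Y u in Yu
    ... | zero with Y≡0⇒c₂ {u} Yu
    ...   | refl = inner i final , bwd (last i final 1+final≡s) ,
      trans (δ-on final) (trans (δ-last 1+final≡s) (trans (sym (+-identityʳ r)) (suc-injective e)))
      where
      final<s : p + r < s i
      final<s = ≤-reflexive (trans (sym (+-suc p r)) p+1+r≡s)
      final : Fin (s i)
      final = fromℕ< final<s
      1+final≡s : suc (toℕ final) ≡ s i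
      1+final≡s = trans (cong suc (Fin.toℕ-fromℕ< final<s)) (trans (sym (+-suc p r)) p+1+r≡s)
    descent-off u u∉i e | suc y with Y-descent u Yu
    ...   | v , u~v , Yv , stays = v , u~v ,
      trans (δ-off v∉i) (trans (cong (suc r +_) Yv) (suc-injective (trans (sym (+-suc (suc r) y)) e)))
      where
      v∉i : ¬ OnPath i v
      v∉i = [ offPath-other (λ 0≡i → i≢0 (sym 0≡i)) , (λ keeps-off → keeps-off u∉i) ] stays

    δ-descent : ∀ {u d} → δ u ≡ suc d → ∃[ v ] (Adj u v × δ v ≡ d)
    δ-descent {u} e with onPath? i u
    ... | yes (k , refl) = descent-on k (trans (sym (δ-on k)) e)
    ... | no u∉i = descent-off u u∉i (trans (sym (δ-off u∉i)) e)

    dist : ∀ u → Dist Adj u landmark (δ u)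
    dist = Dist-by-potential δ δ-lipschitz δ-landmark δ≡0⇒landmark δ-descent

    off-separates : ∀ {u v} → ¬ OnPath i u → ¬ OnPath i v → Y u ≢ Y v → δ u ≢ δ v
    off-separates u∉i v∉i Y≢ eδ =
      Y≢ (+-cancelˡ-≡ (suc r) _ _ (trans (sym (δ-off u∉i)) (trans eδ (δ-off v∉i))))

    -- Before the landmark, equal distances would force r + D + 2 ≤ p, since X u = X v and v lies
    -- on a long path; beyond it, δ u ≤ r < δ v.
    on-separates : ∀ (k : Fin (s i)) {j} (k' : Fin (s j)) → j ≢ i → j ≢ fzero →
      X (inner i k) ≡ X (inner j k') → δ (inner i k) ≢ δ (inner j k')
    on-separates k {j} k' j≢i j≢0 eX eδ with toℕ k <? p
    ... | yes k<p = <-irrefl refl (begin-strict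
      suc (r + D)              <⟨ n<1+n _ ⟩
      suc (suc (r + D))        ≡⟨ trans (+-suc r (suc D)) (cong suc (+-suc r D)) ⟨
      r + (2 + D)              ≤⟨ +-monoʳ-≤ r (on-long-path-sum j≢0 k') ⟩
      r + (X v + Y v)          ≡⟨ cong (λ x → r + (x + Y v)) eX ⟨
      r + (X u + Y v)          ≤⟨ +-monoʳ-≤ r (+-monoˡ-≤ (Y v) (m⊓n≤m (suc a) (suc (after i k) + D))) ⟩
      r + (suc a + Y v)        ≡⟨ swap r a (Y v) ⟩
      a + (suc r + Y v)        ≡⟨ cong (a +_) δu≡p∸a ⟨
      a + (p ∸ a)              ≡⟨ m+[n∸m]≡n (<⇒≤ k<p) ⟩
      p                        ≤⟨ p≤1+r+D ⟩
      suc (r + D)              ∎)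
      where
      open ≤-Reasoning
      u v : V
      u = inner i k
      v = inner j k'
      a : ℕ
      a = toℕ k
      swap : ∀ r a y → r + (suc a + y) ≡ a + (suc r + y)
      swap = solve-∀
      δu≡p∸a : p ∸ a ≡ suc r + Y v
      δu≡p∸a = trans (sym (m≤n⇒∣m-n∣≡n∸m (<⇒≤ k<p)))
                     (trans (sym (δ-on k)) (trans eδ (δ-off (offPath-other j≢i (k' , refl)))))
    ... | no k≮p = 1+n≰n (≤-trans (m≤m+n (suc r) (Y (inner j k'))) (≤-trans (≤-reflexive δv≡δu) δu≤r))
      where
      δv≡δu : suc r + Y (inner j k') ≡ toℕ k ∸ p
      δv≡δu = trans (sym (δ-off (offPath-other j≢i (k' , refl))))
                    (trans (sym eδ) (trans (δ-on k) (m≤n⇒∣n-m∣≡n∸m (≮⇒≥ k≮p))))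
      k≤p+r : toℕ k ≤ p + r
      k≤p+r = ≤-pred (≤-trans (Fin.toℕ<n k) (≤-reflexive (trans (sym p+1+r≡s) (+-suc p r))))
      δu≤r : toℕ k ∸ p ≤ r
      δu≤r = ≤-trans (∸-monoˡ-≤ p k≤p+r) (≤-reflexive (m+n∸m≡n p r))

module Resolution (n : ℕ) (s : Fin (6 + n) → ℕ) (s₀-pos : 1 ≤ s fzero)
  (gap : ∀ j → j ≢ fzero → 2 + s fzero ≤ s j) where

  open Theta s
  open ShortestPathGap s s₀-pos gap

  data Kind : Set where
    near-c₂ near-c₁ : Kind

  placed : Kind → (i : Fin (6 + n)) → i ≢ fzero → V
  placed near-c₂ i i≢0 = Landmark.landmark i i≢0
  placed near-c₁ i i≢0 = reflect (Landmark.landmark i i≢0)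

  placed-onPath : ∀ κ i (i≢0 : i ≢ fzero) → OnPath i (placed κ i i≢0)
  placed-onPath near-c₂ i i≢0 = _ , refl
  placed-onPath near-c₁ i i≢0 = _ , refl

  -- the coordinate a landmark of kind κ reads off vertices outside its path, and the other one
  far close : Kind → V → ℕ
  far near-c₂ = Y
  far near-c₁ = X
  close near-c₂ = X
  close near-c₁ = Y

  close-≡ : ∀ κ {u v} → X u ≡ X v → Y u ≡ Y v → close κ u ≡ close κ v
  close-≡ near-c₂ eX _ = eX
  close-≡ near-c₁ _ eY = eY

  -- Paths 1 and 2 carry a landmark near c₂ and paths 3, …, m − 2 one near c₁; paths 0 and m − 1
  -- carry none.
  landmarkPath : Fin (4 + n) → Fin (6 + n)
  landmarkPath t = fsuc (inject₁ t)

  landmarkPath≢0 : ∀ t → landmarkPath t ≢ fzero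
  landmarkPath≢0 t ()

  kind : Fin (4 + n) → Kind
  kind fzero = near-c₂
  kind (fsuc fzero) = near-c₂
  kind (fsuc (fsuc _)) = near-c₁

  ℓ₁ ℓ₂ ℓ₃ ℓ₄ : Fin (4 + n)
  ℓ₁ = fzero
  ℓ₂ = fsuc fzero
  ℓ₃ = fsuc (fsuc fzero)
  ℓ₄ = fsuc (fsuc (fsuc fzero))

  landmarkAt : Fin (4 + n) → V
  landmarkAt t = placed (kind t) (landmarkPath t) (landmarkPath≢0 t)

  W : List V
  W = tabulate landmarkAt

  landmarkAt-injective : ∀ {t t'} → landmarkAt t ≡ landmarkAt t' → t ≡ t'
  landmarkAt-injective {t} {t'} e = Fin.inject₁-injective (Fin.suc-injective (onPath-unique
    (placed-onPath (kind t) _ _)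
    (subst (OnPath (landmarkPath t')) (sym e) (placed-onPath (kind t') _ _))))

  W-unique : Unique W
  W-unique = Unique.tabulate⁺ landmarkAt-injective

  landmarkPath-covers : ∀ i → i ≢ fzero → i ≢ fromℕ (5 + n) → ∃[ t ] landmarkPath t ≡ i
  landmarkPath-covers fzero i≢0 _ = ⊥-elim (i≢0 refl)
  landmarkPath-covers (fsuc i) _ i≢final = lower₁ i ne , cong fsuc (Fin.inject₁-lower₁ i ne)
    where
    ne : 4 + n ≢ toℕ i
    ne e = i≢final (cong fsuc (Fin.toℕ-injective (trans (sym e) (sym (Fin.toℕ-fromℕ (4 + n))))))

  Distinguished : V → V → Set
  Distinguished u v = ∃[ w ] (w ∈ W × ∃[ a ] ∃[ b ] (Dist Adj u w a × Dist Adj v w b × a ≢ b))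

  distinguished-sym : ∀ {u v} → Distinguished u v → Distinguished v u
  distinguished-sym (w , w∈W , a , b , dist-u , dist-v , a≢b) =
    w , w∈W , b , a , dist-v , dist-u , a≢b ∘ sym

  off-distinguishes : ∀ κ {i} (i≢0 : i ≢ fzero) → placed κ i i≢0 ∈ W → ∀ {u v} →
    ¬ OnPath i u → ¬ OnPath i v → far κ u ≢ far κ v → Distinguished u v
  off-distinguishes near-c₂ {i} i≢0 w∈W {u} {v} u∉i v∉i Y≢ =
    _ , w∈W , _ , _ , L.dist u , L.dist v , L.off-separates u∉i v∉i Y≢
    where module L = Landmark i i≢0
  off-distinguishes near-c₁ {i} i≢0 w∈W {u} {v} u∉i v∉i X≢ =
    _ , w∈W , _ , _ , Dist-reflect (L.dist (reflect u)) , Dist-reflect (L.dist (reflect v)) ,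
    L.off-separates (reflect-offPath u∉i) (reflect-offPath v∉i)
      (λ e → X≢ (trans (sym (Y-reflect u)) (trans e (Y-reflect v))))
    where module L = Landmark i i≢0

  on-distinguishes : ∀ κ {i} (i≢0 : i ≢ fzero) → placed κ i i≢0 ∈ W →
    ∀ (k : Fin (s i)) {j} (k' : Fin (s j)) → j ≢ i → j ≢ fzero →
    close κ (inner i k) ≡ close κ (inner j k') → Distinguished (inner i k) (inner j k')
  on-distinguishes near-c₂ {i} i≢0 w∈W k k' j≢i j≢0 eX =
    _ , w∈W , _ , _ , L.dist _ , L.dist _ , L.on-separates k k' j≢i j≢0 eX
    where module L = Landmark i i≢0
  on-distinguishes near-c₁ {i} i≢0 w∈W k {j} k' j≢i j≢0 eY =
    _ , w∈W , _ , _ , Dist-reflect (L.dist _) , Dist-reflect (L.dist _) ,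
    L.on-separates (opposite k) (opposite k') j≢i j≢0
      (trans (X-reflect (inner i k)) (trans eY (sym (X-reflect (inner j k')))))
    where module L = Landmark i i≢0

  distinguish-off : ∀ t {u v} → ¬ OnPath (landmarkPath t) u → ¬ OnPath (landmarkPath t) v →
    far (kind t) u ≢ far (kind t) v → Distinguished u v
  distinguish-off t = off-distinguishes (kind t) (landmarkPath≢0 t) (∈-tabulate⁺ {f = landmarkAt} t)

  distinguish-on : ∀ t (k : Fin (s (landmarkPath t))) {j} (k' : Fin (s j)) → j ≢ landmarkPath t →
    j ≢ fzero → close (kind t) (inner _ k) ≡ close (kind t) (inner j k') →
    Distinguished (inner _ k) (inner j k')
  distinguish-on t = on-distinguishes (kind t) (landmarkPath≢0 t) (∈-tabulate⁺ {f = landmarkAt} t)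

  distinguish-on-paths₃₄ : ∀ {u v} → OnPath (landmarkPath ℓ₃) u →
    OnPath (landmarkPath ℓ₄) v → Distinguished u v
  distinguish-on-paths₃₄ (k , refl) (k' , refl) with Y (inner _ k) ≟ Y (inner _ k')
  ... | yes Y≡ = distinguish-on ℓ₃ k k' (λ ()) (λ ()) Y≡
  ... | no Y≢ =
    distinguish-off ℓ₁ (offPath-other (λ ()) (k , refl)) (offPath-other (λ ()) (k' , refl)) Y≢

  distinguish-X : ∀ {u v} → X u ≢ X v → Distinguished u v
  distinguish-X {u} {v} X≢ with two-paths {landmarkPath ℓ₃} {landmarkPath ℓ₄} (λ ()) u v
  ... | inj₁ (u∉ , v∉) = distinguish-off ℓ₃ u∉ v∉ X≢
  ... | inj₂ (inj₁ (u∉ , v∉)) = distinguish-off ℓ₄ u∉ v∉ X≢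
  ... | inj₂ (inj₂ (inj₁ (u∈ , v∈))) = distinguish-on-paths₃₄ u∈ v∈
  ... | inj₂ (inj₂ (inj₂ (u∈ , v∈))) = distinguished-sym (distinguish-on-paths₃₄ v∈ u∈)

  distinguish-on-paths₁₂ : ∀ {u v} → X u ≡ X v → OnPath (landmarkPath ℓ₁) u →
    OnPath (landmarkPath ℓ₂) v → Distinguished u v
  distinguish-on-paths₁₂ X≡ (k , refl) (k' , refl) = distinguish-on ℓ₁ k k' (λ ()) (λ ()) X≡

  distinguish-Y : ∀ {u v} → X u ≡ X v → Y u ≢ Y v → Distinguished u v
  distinguish-Y {u} {v} X≡ Y≢ with two-paths {landmarkPath ℓ₁} {landmarkPath ℓ₂} (λ ()) u v
  ... | inj₁ (u∉ , v∉) = distinguish-off ℓ₁ u∉ v∉ Y≢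
  ... | inj₂ (inj₁ (u∉ , v∉)) = distinguish-off ℓ₂ u∉ v∉ Y≢
  ... | inj₂ (inj₂ (inj₁ (u∈ , v∈))) = distinguish-on-paths₁₂ X≡ u∈ v∈
  ... | inj₂ (inj₂ (inj₂ (u∈ , v∈))) = distinguished-sym (distinguish-on-paths₁₂ (sym X≡) v∈ u∈)

  distinguish-on-landmark-path : ∀ {j j'} (k : Fin (s j)) (k' : Fin (s j')) →
    j ≢ fzero → j ≢ fromℕ (5 + n) → j' ≢ j → j' ≢ fzero →
    X (inner j k) ≡ X (inner j' k') → Y (inner j k) ≡ Y (inner j' k') →
    Distinguished (inner j k) (inner j' k')
  distinguish-on-landmark-path {j} k k' j≢0 j≢final j'≢j j'≢0 X≡ Y≡
    with landmarkPath-covers j j≢0 j≢final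
  ... | t , refl = distinguish-on t k k' j'≢j j'≢0 (close-≡ (kind t) X≡ Y≡)

  distinguish-XY : ∀ {u v} → u ≢ v → X u ≡ X v → Y u ≡ Y v → Distinguished u v
  distinguish-XY {c₁} u≢v X≡ _ = ⊥-elim (u≢v (sym (X≡0⇒c₁ (sym X≡))))
  distinguish-XY {c₂} u≢v _ Y≡ = ⊥-elim (u≢v (sym (Y≡0⇒c₂ (sym Y≡))))
  distinguish-XY {inner _ _} {c₁} u≢v X≡ _ = ⊥-elim (u≢v (X≡0⇒c₁ X≡))
  distinguish-XY {inner _ _} {c₂} u≢v _ Y≡ = ⊥-elim (u≢v (Y≡0⇒c₂ Y≡))
  distinguish-XY {inner j k} {inner j' k'} u≢v X≡ Y≡
    with j Fin.≟ j' | j Fin.≟ fzero | j' Fin.≟ fzero | j Fin.≟ fromℕ (5 + n)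
  ... | yes refl | _ | _ | _ = ⊥-elim (u≢v (cong (inner j) (position-unique k k' X≡ Y≡)))
  ... | no j≢j' | yes refl | _ | _ = ⊥-elim (path₀-coordinates-not-shared k k' (j≢j' ∘ sym) X≡ Y≡)
  ... | no j≢j' | no _ | yes refl | _ = ⊥-elim (path₀-coordinates-not-shared k' k j≢j' (sym X≡) (sym Y≡))
  ... | no j≢j' | no j≢0 | no j'≢0 | no j≢final =
    distinguish-on-landmark-path k k' j≢0 j≢final (j≢j' ∘ sym) j'≢0 X≡ Y≡
  ... | no j≢j' | no j≢0 | no j'≢0 | yes refl = distinguished-sym
    (distinguish-on-landmark-path k' k j'≢0 (j≢j' ∘ sym) j≢j' j≢0 (sym X≡) (sym Y≡))

  W-resolving : Resolving Adj W
  W-resolving u v u≢v with X u ≟ X v | Y u ≟ Y v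
  ... | no X≢ | _ = distinguish-X X≢
  ... | yes X≡ | no Y≢ = distinguish-Y X≡ Y≢
  ... | yes X≡ | yes Y≡ = distinguish-XY u≢v X≡ Y≡

  metric-dimension : MetricDim Adj (4 + n)
  metric-dimension = (W , W-unique , W-resolving , length-tabulate landmarkAt) , λ W' _ → lower-bound W'

gap-from-separation : ∀ {m} (s : Fin (suc m) → ℕ) → (∀ i j → toℕ i ≤ toℕ j → s i ≤ s j) →
  (∀ i j → i ≢ j → 2 ≤ ∣ s i - s j ∣) → ∀ j → j ≢ fzero → 2 + s fzero ≤ s j
gap-from-separation s mono sep j j≢0 =
  ≤-trans (+-monoˡ-≤ (s fzero) 2≤sⱼ-s₀) (≤-reflexive (m∸n+n≡m s₀≤sⱼ))
  where
  s₀≤sⱼ : s fzero ≤ s j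
  s₀≤sⱼ = mono fzero j z≤n
  2≤sⱼ-s₀ : 2 ≤ s j ∸ s fzero
  2≤sⱼ-s₀ = subst (2 ≤_) (m≤n⇒∣m-n∣≡n∸m s₀≤sⱼ) (sep fzero j (j≢0 ∘ sym))

mainTheorem15 : (m : ℕ) → 5 < m → (s : Fin m → ℕ) →
    (∀ i → 1 ≤ s i) →
    (∀ i j → toℕ i ≤ toℕ j → s i ≤ s j) →
    (∀ i j → i ≢ j → 2 ≤ ∣ s i - s j ∣) →
    MetricDim (ThetaAdj m s) (m ∸ 2)
mainTheorem15 _ (s≤s (s≤s (s≤s (s≤s (s≤s (s≤s (z≤n {n}))))))) s pos mono sep =
  Resolution.metric-dimension n s (pos fzero) (gap-from-separation s mono sep)
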